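{- Let $P : A \to \mathsf{Prop}$ and define $i_P : \mathsf{Prop}\to\mathsf{Prop}$ by $i_P\,s := \exists a{:}A.\,(P\,a \Rightarrow s)$. Then $\mathcal{O}_P$ is the least modality above $i_P$: we have $\forall s.\; i_P\,s \Rightarrow \mathcal{O}_P\,s$, and for every modality $j$ with $\forall s.\; i_P\,s\Rightarrow j\,s$ we have $\mathcal{O}_P \le j$.
   Context: We work in the Calculus of Inductive Constructions with an impredicative universe $\mathsf{Prop}$ of proof-irrelevant propositions, together with function extensionality, propositional extensionality, uniqueness of proofs of propositions, and definite description. A modality is a map $j : \mathsf{Prop} \to \mathsf{Prop}$ that is monotone, inflationary ($p\Rightarrow j\,p$) and idempotent ($j(j\,p)\Rightarrow j\,p$); modalities are ordered pointwise. For $P : A \to \mathsf{Prop}$, the oracle modality $\mathcal{O}_P$ is defined at $s:\mathsf{Prop}$ as the inductive proposition with constructors $\mathsf{prf} : s \to \mathcal{O}_P\,s$ and $\mathsf{ask} : \prod_{a:A} (P\,a \to \mathcal{O}_P\,s) \to \mathcal{O}_P\,s$. -}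

module Defs where

open import Level using (Level; _⊔_; suc)
open import Data.Product using (∃)

-- Propositions are rendered as types in a fixed universe `Set ℓ`
-- (logical reading: implication = function, ∃ = Σ).

record IsModality {ℓ : Level} (j : Set ℓ → Set ℓ) : Set (suc ℓ) where
  field
    monotone     : ∀ {p q : Set ℓ} → (p → q) → j p → j q
    inflationary : ∀ {p : Set ℓ} → p → j p
    idempotent   : ∀ {p : Set ℓ} → j (j p) → j p

_≤ₘ_ : {ℓ : Level} → (Set ℓ → Set ℓ) → (Set ℓ → Set ℓ) → Set (suc ℓ)
j ≤ₘ k = ∀ s → j s → k s

data Oracle {ℓ : Level} {A : Set ℓ} (P : A → Set ℓ) (s : Set ℓ) : Set ℓ where
  prf : s → Oracle P s
  ask : (a : A) → (P a → Oracle P s) → Oracle P s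

iP : {ℓ : Level} {A : Set ℓ} (P : A → Set ℓ) → Set ℓ → Set ℓ
iP {A = A} P s = ∃ λ (a : A) → P a → s

-- An oracle computation is a well-founded tree of queries to P ending in a proof.
-- Any modality j above i_P can answer a single query, turning a j-valued
-- continuation P a → j s into j (j s), which collapses to j s by idempotence;
-- hence every tree can be evaluated in j by recursion on its structure.
module Submission where

open import Defs
open import Level using (Level)
open import Data.Product using (_×_; _,_)

module _ {ℓ : Level} {A : Set ℓ} (P : A → Set ℓ) where

  Oracle-map : ∀ {p q : Set ℓ} → (p → q) → Oracle P p → Oracle P q
  Oracle-map f (prf x)   = prf (f x)
  Oracle-map f (ask a k) = ask a (λ x → Oracle-map f (k x))

  Oracle-join : ∀ {p : Set ℓ} → Oracle P (Oracle P p) → Oracle P p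
  Oracle-join (prf x)   = x
  Oracle-join (ask a k) = ask a (λ x → Oracle-join (k x))

  Oracle-isModality : IsModality (Oracle P)
  Oracle-isModality = record
    { monotone     = Oracle-map
    ; inflationary = prf
    ; idempotent   = Oracle-join
    }

  iP≤Oracle : ∀ s → iP P s → Oracle P s
  iP≤Oracle s (a , f) = ask a (λ x → prf (f x))

  Oracle-least : (j : Set ℓ → Set ℓ) → IsModality j →
                 (∀ s → iP P s → j s) → Oracle P ≤ₘ j
  Oracle-least j isModality iP≤j s = run
    where
    open IsModality isModality

    run : Oracle P s → j s
    run (prf x)   = inflationary x
    run (ask a k) = idempotent (iP≤j (j s) (a , λ x → run (k x)))

proposition12 : {ℓ : Level} {A : Set ℓ} (P : A → Set ℓ) →
    IsModality (Oracle P) ×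
    ((∀ s → iP P s → Oracle P s) ×
    ((j : Set ℓ → Set ℓ) → IsModality j → (∀ s → iP P s → j s) → Oracle P ≤ₘ j))
proposition12 P = Oracle-isModality P , iP≤Oracle P , Oracle-least P
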